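{- Let $m\ge 0$ and let $(a,b)$ be the final position of a walk of length $m$ in $\mathbb{Z}^2$ starting at $(2,1)$ in which every step has the form $(c,d)\to(d+1,i)$ for some $i\in\{1,\dots,c\}$. Then $2\le a\le\lfloor\frac{m+4}{2}\rfloor$ and $1\le b\le\lceil\frac{m+2}{2}\rceil$. -}

module Defs where

open import Data.Nat using (ℕ; zero; suc)
open import Data.Integer using (ℤ; +_; _+_; _≤_)
open import Data.Product using (_×_; _,_)

data Step : ℤ × ℤ → ℤ × ℤ → Set where
  step : ∀ {c d i} → + 1 ≤ i → i ≤ c → Step (c , d) (d + + 1 , i)

data Walk : ℕ → ℤ × ℤ → ℤ × ℤ → Set where
  done : ∀ {p} → Walk zero p p
  next : ∀ {m p q r} → Walk m p q → Step q r → Walk (suc m) p r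

-- The invariant 2 ≤ a ≤ A m and 1 ≤ b ≤ B m, with A m = ⌊(m+4)/2⌋ and
-- B m = ⌊(m+3)/2⌋, is preserved by a step: the new first coordinate is d + 1
-- with d ≤ B m, and the new second coordinate is some i ≤ c ≤ A m.  The bounds
-- interlock exactly, since A (m + 1) = B m + 1 and B (m + 1) = A m.
module Submission where

open import Defs
open import Data.Nat using (ℕ; _+_; suc; zero; s≤s; z≤n)
open import Data.Nat.DivMod using (_/_; m/n≡1+[m∸n]/n)
open import Data.Integer using (ℤ; +_; _≤_)
import Data.Integer as ℤ
open import Data.Nat.Properties using (+-suc; +-comm)
open import Data.Integer.Properties using (≤-refl; ≤-trans; +-monoˡ-≤)
open import Data.Product using (_×_; _,_)
open import Relation.Binary.PropositionalEquality using (_≡_; sym; cong; subst; module ≡-Reasoning)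

step-bounds : ∀ {c d a b α β : ℤ} → Step (c , d) (a , b) →
  + 1 ≤ d → d ≤ β → c ≤ α →
  (+ 2 ≤ a × a ≤ β ℤ.+ + 1) × (+ 1 ≤ b × b ≤ α)
step-bounds (step 1≤i i≤c) 1≤d d≤β c≤α =
  (+-monoˡ-≤ (+ 1) 1≤d , +-monoˡ-≤ (+ 1) d≤β) , (1≤i , ≤-trans i≤c c≤α)

[2+n]/2≡1+n/2 : ∀ n → (2 + n) / 2 ≡ 1 + n / 2
[2+n]/2≡1+n/2 n = m/n≡1+[m∸n]/n {2 + n} (s≤s (s≤s z≤n))

[1+m+4]/2≡[m+3]/2+1 : ∀ m → (suc m + 4) / 2 ≡ (m + 3) / 2 + 1
[1+m+4]/2≡[m+3]/2+1 m = begin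
  (suc m + 4) / 2     ≡⟨ cong (λ k → suc k / 2) (+-suc m 3) ⟩
  (2 + (m + 3)) / 2   ≡⟨ [2+n]/2≡1+n/2 (m + 3) ⟩
  1 + (m + 3) / 2     ≡⟨ +-comm 1 ((m + 3) / 2) ⟩
  (m + 3) / 2 + 1     ∎
  where open ≡-Reasoning

lemma3p8 : (m : ℕ) (a b : ℤ) → Walk m (+ 2 , + 1) (a , b) →
    (+ 2 ≤ a × a ≤ + ((m + 4) / 2)) × (+ 1 ≤ b × b ≤ + ((m + 3) / 2))
lemma3p8 zero _ _ done = (≤-refl , ≤-refl) , (≤-refl , ≤-refl)
lemma3p8 (suc m) a b (next {q = c , d} w s) =
  let (_ , c≤A) , (1≤d , d≤B) = lemma3p8 m c d w
      (2≤a , a≤B+1) , (1≤b , b≤A) = step-bounds s 1≤d d≤B c≤A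
  in  (2≤a , subst (λ k → a ≤ + k) (sym ([1+m+4]/2≡[m+3]/2+1 m)) a≤B+1)
    , (1≤b , subst (λ k → b ≤ + (k / 2)) (+-suc m 3) b≤A)
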